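{- Let $\mathcal L$ be a Seely category and $(F,\varphi)$ an $(n+1)$-ary strong functor on $\mathcal L$ (with $F:\mathcal L^n\times\mathcal L\to\mathcal L$) such that for each $\vec X\in\mathcal L^n$ the category of coalgebras of $F(\vec X,-)$ has a final object of the form $(Z_{\vec X},\mathrm{Id})$ with $F(\vec X,Z_{\vec X})=Z_{\vec X}$. Then there is a unique $n$-ary strong functor $(\nu F,\psi)$ on $\mathcal L$ such that $\nu F(\vec X)=Z_{\vec X}$ (hence $F(\vec X,\nu F(\vec X))=\nu F(\vec X)$) for all $\vec X$, $F(\vec f,\nu F(\vec f))=\nu F(\vec f)$ for all $\vec f\in\mathcal L^n(\vec X,\vec X')$, and $F(!Y\otimes\vec X,\psi_{Y,\vec X})\circ\varphi_{Y,(\vec X,\nu F(\vec X))}=\psi_{Y,\vec X}$ for all objects $Y$ and $\vec X$.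
   Context: A Seely category is a symmetric monoidal closed, $*$-autonomous category $(\mathcal L,\otimes,1)$ which is cartesian (terminal object $\top$, product $\&$) and has a comonad $!$ with counit $\mathrm{der}$ and comultiplication $\mathrm{dig}$, with a strong symmetric monoidal structure $m^0:1\to!\top$, $m^2_{X_1,X_2}:!X_1\otimes!X_2\to!(X_1\&X_2)$ (isos) compatible with $\mathrm{dig}$. For objects $Z$ and $\vec Y=(Y_1,\dots,Y_n)$ write $Z\otimes\vec Y=(Z\otimes Y_1,\dots,Z\otimes Y_n)$. An $n$-ary strong functor is a pair $(F,\varphi)$ with $F:\mathcal L^n\to\mathcal L$ a functor and $\varphi_{X,\vec Y}:!X\otimes F(\vec Y)\to F(!X\otimes\vec Y)$ a natural transformation such that, up to the monoidal coherence isomorphisms: $\varphi_{X_1\&X_2,\vec Y}\circ(m^2_{X_1,X_2}\otimes F(\vec Y))=F(m^2_{X_1,X_2}\otimes\vec Y)\circ\varphi_{X_1,!X_2\otimes\vec Y}\circ(!X_1\otimes\varphi_{X_2,\vec Y})$; $\varphi_{\top,\vec Y}\circ(m^0\otimes F(\vec Y))=F(m^0\otimes\vec Y)$ (identifying $1\otimes F(\vec Y)$ with $F(1\otimes\vec Y)$ via unitors); $\varphi_{!X,\vec Y}\circ(\mathrm{dig}_X\otimes F(\vec Y))=F(\mathrm{dig}_X\otimes\vec Y)\circ\varphi_{X,\vec Y}$. A coalgebra of an endofunctor $G$ is a pair $(A,f:A\to G(A))$, morphisms $h:(A,f)\to(A',f')$ satisfy $f'\circ h=G(h)\circ f$. 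-}

module Defs where

open import Level using (Level; _⊔_) renaming (suc to lsuc)
open import Relation.Binary.Structures using (IsEquivalence)
open import Relation.Binary.PropositionalEquality using (_≡_; refl)
open import Data.Product using (Σ; _×_; _,_; Σ-syntax; proj₁)
open import Data.Sum using (_⊎_; inj₁; inj₂)
open import Data.Unit using (⊤; tt)

record Category (o ℓ e : Level) : Set (lsuc (o ⊔ ℓ ⊔ e)) where
  infixr 9 _∘_
  infix  4 _≈_ _⇒_
  field
    Obj : Set o
    _⇒_ : Obj → Obj → Set ℓ
    _≈_ : ∀ {A B} → A ⇒ B → A ⇒ B → Set e
    id  : ∀ {A} → A ⇒ A
    _∘_ : ∀ {A B C} → B ⇒ C → A ⇒ B → A ⇒ C
    ≈-equiv   : ∀ {A B} → IsEquivalence (_≈_ {A} {B})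
    assoc     : ∀ {A B C D} {f : A ⇒ B} {g : B ⇒ C} {h : C ⇒ D} →
                (h ∘ g) ∘ f ≈ h ∘ (g ∘ f)
    identityˡ : ∀ {A B} {f : A ⇒ B} → id ∘ f ≈ f
    identityʳ : ∀ {A B} {f : A ⇒ B} → f ∘ id ≈ f
    ∘-resp-≈  : ∀ {A B C} {f h : B ⇒ C} {g i : A ⇒ B} →
                f ≈ h → g ≈ i → f ∘ g ≈ h ∘ i

  toHom : ∀ {A B} → A ≡ B → A ⇒ B
  toHom refl = id

record Monoidal {o ℓ e} (C : Category o ℓ e) : Set (o ⊔ ℓ ⊔ e) where
  open Category C
  infixr 10 _⊗₀_ _⊗₁_
  field
    _⊗₀_ : Obj → Obj → Obj
    _⊗₁_ : ∀ {A B C D} → A ⇒ B → C ⇒ D → A ⊗₀ C ⇒ B ⊗₀ D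
    ⊗-id     : ∀ {A B} → id {A} ⊗₁ id {B} ≈ id
    ⊗-∘      : ∀ {A B C D E F} {f : B ⇒ C} {g : A ⇒ B} {h : E ⇒ F} {k : D ⇒ E} →
               (f ∘ g) ⊗₁ (h ∘ k) ≈ (f ⊗₁ h) ∘ (g ⊗₁ k)
    ⊗-resp-≈ : ∀ {A B C D} {f f' : A ⇒ B} {g g' : C ⇒ D} →
               f ≈ f' → g ≈ g' → f ⊗₁ g ≈ f' ⊗₁ g'
    unit : Obj
    λ⇒ : ∀ {A} → unit ⊗₀ A ⇒ A
    λ⇐ : ∀ {A} → A ⇒ unit ⊗₀ A
    λ-isoˡ : ∀ {A} → λ⇐ {A} ∘ λ⇒ ≈ id
    λ-isoʳ : ∀ {A} → λ⇒ {A} ∘ λ⇐ ≈ id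
    λ-natural : ∀ {A B} {f : A ⇒ B} → f ∘ λ⇒ ≈ λ⇒ ∘ (id ⊗₁ f)
    ρ⇒ : ∀ {A} → A ⊗₀ unit ⇒ A
    ρ⇐ : ∀ {A} → A ⇒ A ⊗₀ unit
    ρ-isoˡ : ∀ {A} → ρ⇐ {A} ∘ ρ⇒ ≈ id
    ρ-isoʳ : ∀ {A} → ρ⇒ {A} ∘ ρ⇐ ≈ id
    ρ-natural : ∀ {A B} {f : A ⇒ B} → f ∘ ρ⇒ ≈ ρ⇒ ∘ (f ⊗₁ id)
    α⇒ : ∀ {A B C} → (A ⊗₀ B) ⊗₀ C ⇒ A ⊗₀ (B ⊗₀ C)
    α⇐ : ∀ {A B C} → A ⊗₀ (B ⊗₀ C) ⇒ (A ⊗₀ B) ⊗₀ C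
    α-isoˡ : ∀ {A B C} → α⇐ {A} {B} {C} ∘ α⇒ ≈ id
    α-isoʳ : ∀ {A B C} → α⇒ {A} {B} {C} ∘ α⇐ ≈ id
    α-natural : ∀ {A A' B B' C C'} {f : A ⇒ A'} {g : B ⇒ B'} {h : C ⇒ C'} →
                α⇒ ∘ ((f ⊗₁ g) ⊗₁ h) ≈ (f ⊗₁ (g ⊗₁ h)) ∘ α⇒
    triangle : ∀ {A B} → (id {A} ⊗₁ λ⇒ {B}) ∘ α⇒ ≈ ρ⇒ ⊗₁ id
    pentagon : ∀ {A B C D} →
               (id {A} ⊗₁ α⇒ {B} {C} {D}) ∘ (α⇒ ∘ (α⇒ ⊗₁ id)) ≈ α⇒ ∘ α⇒

record Symmetric {o ℓ e} {C : Category o ℓ e} (M : Monoidal C) : Set (o ⊔ ℓ ⊔ e) where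
  open Category C
  open Monoidal M
  field
    σ : ∀ {A B} → A ⊗₀ B ⇒ B ⊗₀ A
    σ-natural : ∀ {A A' B B'} {f : A ⇒ A'} {g : B ⇒ B'} →
                σ ∘ (f ⊗₁ g) ≈ (g ⊗₁ f) ∘ σ
    σ-involutive : ∀ {A B} → σ {B} {A} ∘ σ {A} {B} ≈ id
    hexagon : ∀ {A B C} →
              (id {B} ⊗₁ σ {A} {C}) ∘ (α⇒ ∘ (σ {A} {B} ⊗₁ id {C}))
                ≈ α⇒ ∘ (σ {A} {B ⊗₀ C} ∘ α⇒)

record Closed {o ℓ e} {C : Category o ℓ e} (M : Monoidal C) : Set (o ⊔ ℓ ⊔ e) where
  open Category C
  open Monoidal M
  infixr 5 _⊸_
  field
    _⊸_   : Obj → Obj → Obj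
    ev    : ∀ {B C} → (B ⊸ C) ⊗₀ B ⇒ C
    curry : ∀ {A B C} → A ⊗₀ B ⇒ C → A ⇒ B ⊸ C
    curry-β : ∀ {A B C} {f : A ⊗₀ B ⇒ C} → ev ∘ (curry f ⊗₁ id) ≈ f
    curry-unique : ∀ {A B C} {f : A ⊗₀ B ⇒ C} {g : A ⇒ B ⊸ C} →
                   ev ∘ (g ⊗₁ id) ≈ f → g ≈ curry f

record StarAutonomous {o ℓ e} {C : Category o ℓ e} {M : Monoidal C}
                      (S : Symmetric M) (K : Closed M) : Set (o ⊔ ℓ ⊔ e) where
  open Category C
  open Monoidal M
  open Symmetric S
  open Closed K
  field
    ⊥ : Obj

  ∂ : ∀ {X} → X ⇒ (X ⊸ ⊥) ⊸ ⊥
  ∂ {X} = curry (ev {X} {⊥} ∘ σ)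

  field
    ∂⁻¹    : ∀ {X} → (X ⊸ ⊥) ⊸ ⊥ ⇒ X
    ∂-isoˡ : ∀ {X} → ∂⁻¹ ∘ ∂ {X} ≈ id
    ∂-isoʳ : ∀ {X} → ∂ {X} ∘ ∂⁻¹ ≈ id

record Cartesian {o ℓ e} (C : Category o ℓ e) : Set (o ⊔ ℓ ⊔ e) where
  open Category C
  infixr 7 _&_
  field
    ⊤ₒ : Obj
    term : ∀ {A} → A ⇒ ⊤ₒ
    term-unique : ∀ {A} (f : A ⇒ ⊤ₒ) → f ≈ term
    _&_ : Obj → Obj → Obj
    π₁ : ∀ {A B} → A & B ⇒ A
    π₂ : ∀ {A B} → A & B ⇒ B
    ⟨_,_⟩ : ∀ {A B C} → C ⇒ A → C ⇒ B → C ⇒ A & B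
    project₁ : ∀ {A B C} {f : C ⇒ A} {g : C ⇒ B} → π₁ ∘ ⟨ f , g ⟩ ≈ f
    project₂ : ∀ {A B C} {f : C ⇒ A} {g : C ⇒ B} → π₂ ∘ ⟨ f , g ⟩ ≈ g
    pair-unique : ∀ {A B C} {f : C ⇒ A} {g : C ⇒ B} {h : C ⇒ A & B} →
                  π₁ ∘ h ≈ f → π₂ ∘ h ≈ g → h ≈ ⟨ f , g ⟩

  _&₁_ : ∀ {A B C D} → A ⇒ B → C ⇒ D → A & C ⇒ B & D
  f &₁ g = ⟨ f ∘ π₁ , g ∘ π₂ ⟩

  α& : ∀ {A B C} → (A & B) & C ⇒ A & (B & C)
  α& = ⟨ π₁ ∘ π₁ , ⟨ π₂ ∘ π₁ , π₂ ⟩ ⟩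

  σ& : ∀ {A B} → A & B ⇒ B & A
  σ& = ⟨ π₂ , π₁ ⟩

record SeelyExponential {o ℓ e} {C : Category o ℓ e} {M : Monoidal C}
                        (S : Symmetric M) (P : Cartesian C) : Set (o ⊔ ℓ ⊔ e) where
  open Category C
  open Monoidal M
  open Symmetric S
  open Cartesian P
  field
    !₀ : Obj → Obj
    !₁ : ∀ {A B} → A ⇒ B → !₀ A ⇒ !₀ B
    !-id : ∀ {A} → !₁ (id {A}) ≈ id
    !-∘  : ∀ {A B C} {f : B ⇒ C} {g : A ⇒ B} → !₁ (f ∘ g) ≈ !₁ f ∘ !₁ g
    !-resp-≈ : ∀ {A B} {f g : A ⇒ B} → f ≈ g → !₁ f ≈ !₁ g
    der : ∀ {A} → !₀ A ⇒ A
    der-natural : ∀ {A B} {f : A ⇒ B} → f ∘ der ≈ der ∘ !₁ f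
    dig : ∀ {A} → !₀ A ⇒ !₀ (!₀ A)
    dig-natural : ∀ {A B} {f : A ⇒ B} → !₁ (!₁ f) ∘ dig ≈ dig ∘ !₁ f
    comonad-idˡ : ∀ {A} → der { !₀ A } ∘ dig ≈ id
    comonad-idʳ : ∀ {A} → !₁ (der {A}) ∘ dig ≈ id
    comonad-assoc : ∀ {A} → dig { !₀ A } ∘ dig ≈ !₁ dig ∘ dig
    m⁰ : unit ⇒ !₀ ⊤ₒ
    m⁰⁻¹ : !₀ ⊤ₒ ⇒ unit
    m⁰-isoˡ : m⁰⁻¹ ∘ m⁰ ≈ id
    m⁰-isoʳ : m⁰ ∘ m⁰⁻¹ ≈ id
    m² : ∀ {A B} → !₀ A ⊗₀ !₀ B ⇒ !₀ (A & B)
    m²⁻¹ : ∀ {A B} → !₀ (A & B) ⇒ !₀ A ⊗₀ !₀ B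
    m²-isoˡ : ∀ {A B} → m²⁻¹ ∘ m² {A} {B} ≈ id
    m²-isoʳ : ∀ {A B} → m² {A} {B} ∘ m²⁻¹ ≈ id
    m²-natural : ∀ {A A' B B'} {f : A ⇒ A'} {g : B ⇒ B'} →
                 !₁ (f &₁ g) ∘ m² ≈ m² ∘ (!₁ f ⊗₁ !₁ g)
    m-assoc : ∀ {A B C} →
              !₁ (α& {A} {B} {C}) ∘ (m² ∘ (m² ⊗₁ id))
                ≈ m² ∘ ((id ⊗₁ m²) ∘ α⇒)
    m-unitˡ : ∀ {A} → !₁ (π₂ {⊤ₒ} {A}) ∘ (m² ∘ (m⁰ ⊗₁ id)) ≈ λ⇒
    m-unitʳ : ∀ {A} → !₁ (π₁ {A} {⊤ₒ}) ∘ (m² ∘ (id ⊗₁ m⁰)) ≈ ρ⇒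
    m-sym   : ∀ {A B} → !₁ (σ& {A} {B}) ∘ m² ≈ m² ∘ σ
    dig-m² : ∀ {A B} →
             !₁ ⟨ !₁ π₁ , !₁ π₂ ⟩ ∘ (dig {A & B} ∘ m²) ≈ m² ∘ (dig ⊗₁ dig)
    dig-m⁰ : !₁ term ∘ (dig ∘ m⁰) ≈ m⁰

record SeelyCategory (o ℓ e : Level) : Set (lsuc (o ⊔ ℓ ⊔ e)) where
  field
    category       : Category o ℓ e
    monoidal       : Monoidal category
    symmetric      : Symmetric monoidal
    closed         : Closed monoidal
    starAutonomous : StarAutonomous symmetric closed
    cartesian      : Cartesian category
    exponential    : SeelyExponential symmetric cartesian
  open Category category public
  open Monoidal monoidal public
  open Symmetric symmetric public
  open Closed closed public
  open StarAutonomous starAutonomous public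
  open Cartesian cartesian public
  open SeelyExponential exponential public

module _ {o ℓ e} (L : SeelyCategory o ℓ e) where
  open SeelyCategory L

  Objs : Set → Set o
  Objs I = I → Obj

  Homs : ∀ {I} → Objs I → Objs I → Set ℓ
  Homs X Y = ∀ i → X i ⇒ Y i

  _⊗⃗_ : ∀ {I} → Obj → Objs I → Objs I
  (Z ⊗⃗ X) i = Z ⊗₀ X i

  record StrongFunctorOn (I : Set) (F₀ : Objs I → Obj) : Set (o ⊔ ℓ ⊔ e) where
    field
      F₁ : ∀ {X Y : Objs I} → Homs X Y → F₀ X ⇒ F₀ Y
      F-id : ∀ {X} → F₁ {X} (λ i → id) ≈ id
      F-∘  : ∀ {X Y W} {f : Homs Y W} {g : Homs X Y} →
             F₁ (λ i → f i ∘ g i) ≈ F₁ f ∘ F₁ g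
      F-resp-≈ : ∀ {X Y} {f g : Homs X Y} → (∀ i → f i ≈ g i) → F₁ f ≈ F₁ g
      φ : ∀ (X : Obj) (Y : Objs I) → !₀ X ⊗₀ F₀ Y ⇒ F₀ (!₀ X ⊗⃗ Y)
      φ-natural : ∀ {X X' Y Y'} {f : X ⇒ X'} {g : Homs Y Y'} →
                  F₁ (λ i → !₁ f ⊗₁ g i) ∘ φ X Y ≈ φ X' Y' ∘ (!₁ f ⊗₁ F₁ g)
      φ-m² : ∀ {X₁ X₂ Y} →
             φ (X₁ & X₂) Y ∘ (m² ⊗₁ id)
               ≈ F₁ (λ i → (m² ⊗₁ id) ∘ α⇐) ∘ (φ X₁ (!₀ X₂ ⊗⃗ Y) ∘ ((id ⊗₁ φ X₂ Y) ∘ α⇒))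
      φ-m⁰ : ∀ {Y} →
             φ ⊤ₒ Y ∘ (m⁰ ⊗₁ id) ≈ F₁ (λ i → (m⁰ ⊗₁ id) ∘ λ⇐) ∘ λ⇒
      φ-dig : ∀ {X Y} →
              φ (!₀ X) Y ∘ (dig ⊗₁ id) ≈ F₁ (λ i → dig ⊗₁ id) ∘ φ X Y

  StrongFunctor : Set → Set (o ⊔ ℓ ⊔ e)
  StrongFunctor I = Σ (Objs I → Obj) (StrongFunctorOn I)

  SameStrongFunctor : ∀ {I F₀} → StrongFunctorOn I F₀ → StrongFunctorOn I F₀ → Set (o ⊔ ℓ ⊔ e)
  SameStrongFunctor G H =
    (∀ {X Y} (f : Homs X Y) → StrongFunctorOn.F₁ G f ≈ StrongFunctorOn.F₁ H f) ×
    (∀ X Y → StrongFunctorOn.φ G X Y ≈ StrongFunctorOn.φ H X Y)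

  record Endofunctor : Set (o ⊔ ℓ ⊔ e) where
    field
      G₀ : Obj → Obj
      G₁ : ∀ {A B} → A ⇒ B → G₀ A ⇒ G₀ B
      G-id : ∀ {A} → G₁ (id {A}) ≈ id
      G-∘  : ∀ {A B C} {f : B ⇒ C} {g : A ⇒ B} → G₁ (f ∘ g) ≈ G₁ f ∘ G₁ g
      G-resp-≈ : ∀ {A B} {f g : A ⇒ B} → f ≈ g → G₁ f ≈ G₁ g

  IsCoalgebraMorphism : (G : Endofunctor) {A B : Obj} →
                        A ⇒ Endofunctor.G₀ G A → B ⇒ Endofunctor.G₀ G B → A ⇒ B → Set e
  IsCoalgebraMorphism G a b h = b ∘ h ≈ Endofunctor.G₁ G h ∘ a

  IsFinalCoalgebra : (G : Endofunctor) (Z : Obj) → Z ⇒ Endofunctor.G₀ G Z → Set (o ⊔ ℓ ⊔ e)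
  IsFinalCoalgebra G Z z =
    ∀ (A : Obj) (a : A ⇒ Endofunctor.G₀ G A) →
      Σ (A ⇒ Z) λ h → IsCoalgebraMorphism G a z h ×
        (∀ h' → IsCoalgebraMorphism G a z h' → h' ≈ h)

  -- L^n × L is L^(Fin n ⊎ ⊤); (X⃗ , Z) ∈ L^n × L
  ext : ∀ {n : Set} → Objs n → Obj → Objs (n ⊎ ⊤)
  ext X Z (inj₁ i) = X i
  ext X Z (inj₂ _) = Z

  extᴴ : ∀ {n : Set} {D : Objs (n ⊎ ⊤)} {X : Objs n} {Z : Obj} →
         (∀ i → D (inj₁ i) ⇒ X i) → D (inj₂ tt) ⇒ Z → Homs D (ext X Z)
  extᴴ f g (inj₁ i) = f i
  extᴴ f g (inj₂ _) = g

  section : ∀ {n : Set} → StrongFunctor (n ⊎ ⊤) → Objs n → Endofunctor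
  section {n} (F₀ , F) X = record
    { G₀ = λ A → F₀ (ext X A)
    ; G₁ = λ h → F₁ (extᴴ (λ i → id) h)
    ; G-id = F-resp-≈ pid ⟨trans⟩ F-id
    ; G-∘ = F-resp-≈ p∘ ⟨trans⟩ F-∘
    ; G-resp-≈ = λ p → F-resp-≈ (presp p)
    }
    where
    open StrongFunctorOn F
    open IsEquivalence using () renaming (refl to ≈refl; sym to ≈sym; trans to ≈trans)
    _⟨trans⟩_ : ∀ {A B} {f g h : A ⇒ B} → f ≈ g → g ≈ h → f ≈ h
    _⟨trans⟩_ = ≈trans ≈-equiv
    pid : ∀ {A} → ∀ i → extᴴ {D = ext X A} (λ j → id) id i ≈ id
    pid (inj₁ i) = ≈refl ≈-equiv
    pid (inj₂ _) = ≈refl ≈-equiv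
    p∘ : ∀ {A B C} {f : B ⇒ C} {g : A ⇒ B} → ∀ i →
         extᴴ {D = ext X A} (λ j → id) (f ∘ g) i
           ≈ extᴴ {D = ext X B} (λ j → id) f i ∘ extᴴ {D = ext X A} (λ j → id) g i
    p∘ (inj₁ i) = ≈sym ≈-equiv identityˡ
    p∘ (inj₂ _) = ≈refl ≈-equiv
    presp : ∀ {A B} {f g : A ⇒ B} → f ≈ g → ∀ i →
            extᴴ {D = ext X A} (λ j → id) f i ≈ extᴴ {D = ext X A} (λ j → id) g i
    presp p (inj₁ i) = ≈refl ≈-equiv
    presp p (inj₂ _) = p

  -- the conditions characterising (νF , ψ) in Lemma 2.3, for a given
  -- choice of fixpoints F(X⃗ , Z X⃗) = Z X⃗ (the identity F(X⃗,Z X⃗) → Z X⃗ is toHom (fix X⃗))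
  IsNuOf : ∀ {n : Set} (F : StrongFunctor (n ⊎ ⊤)) (Z : Objs n → Obj) →
           (∀ X → proj₁ F (ext X (Z X)) ≡ Z X) → StrongFunctorOn n Z → Set (o ⊔ ℓ ⊔ e)
  IsNuOf {n} (F₀ , F) Z fix N =
    -- F(f⃗ , νF(f⃗)) = νF(f⃗)
    (∀ {X X'} (f : Homs X X') →
       toHom (fix X') ∘ F.F₁ (extᴴ f (N.F₁ f)) ≈ N.F₁ f ∘ toHom (fix X)) ×
    -- F(!Y ⊗ X⃗ , ψ_{Y,X⃗}) ∘ φ_{Y,(X⃗,νF(X⃗))} = ψ_{Y,X⃗}
    (∀ (Y : Obj) (X : Objs n) →
       toHom (fix (!₀ Y ⊗⃗ X)) ∘ (F.F₁ (extᴴ (λ i → id) (N.φ Y X)) ∘ F.φ Y (ext X (Z X)))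
         ≈ N.φ Y X ∘ (id ⊗₁ toHom (fix X)))
    where
    module F = StrongFunctorOn F
    module N = StrongFunctorOn N

-- The finality of each Z X gives more than coiteration of coalgebras: for every
-- "generalised coalgebra" b : A → F(D) together with morphisms k : D₁ → X on the
-- parameters and l : D₂ → A on the recursive argument there is a unique h : A → Z X
-- with h = F(k , h ∘ l) ∘ b (reading Z X = F(X , Z X)), namely the coiteration of the
-- ordinary coalgebra F(k , l) ∘ b.  The action of νF on f is the solution for
-- (b , k , l) = (id , f , id), and the strength ψ_{Y,X} the solution for
-- (φ_{Y,(X,Z X)} , id , id).  Every functor and strength law is an equation between two
-- morphisms solving the same problem, hence holds by uniqueness; and the defining
-- equations of any other (νF' , ψ') say exactly that its components are solutions too.
module Submission where

open import Data.Nat using (ℕ)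
open import Data.Fin using (Fin)
open import Data.Sum using (_⊎_; inj₁; inj₂)
open import Data.Unit using (⊤; tt)
open import Data.Product using (Σ; _×_; proj₁; proj₂; _,_)
open import Relation.Binary.Bundles using (Setoid)
open import Relation.Binary.PropositionalEquality using (_≡_; refl; sym)
open import Relation.Binary.Structures using (IsEquivalence)
import Relation.Binary.Reasoning.Setoid as SetoidReasoning
open import Defs

module CategoryLemmas {o ℓ e} (C : Category o ℓ e) where
  open Category C

  hom-setoid : ∀ {A B} → Setoid ℓ e
  hom-setoid {A} {B} = record { isEquivalence = ≈-equiv {A} {B} }

  module _ {A B : Obj} where
    open IsEquivalence (≈-equiv {A} {B}) public
      using () renaming (refl to ≈-refl; sym to ≈-sym; trans to ≈-trans)
    open SetoidReasoning (hom-setoid {A} {B}) public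

  infixr 4 _⟩∘⟨_
  infixl 5 _⟩∘⟨refl
  infixr 5 refl⟩∘⟨_

  _⟩∘⟨_ : ∀ {A B C} {f h : B ⇒ C} {g i : A ⇒ B} → f ≈ h → g ≈ i → f ∘ g ≈ h ∘ i
  _⟩∘⟨_ = ∘-resp-≈

  _⟩∘⟨refl : ∀ {A B C} {f h : B ⇒ C} {g : A ⇒ B} → f ≈ h → f ∘ g ≈ h ∘ g
  p ⟩∘⟨refl = p ⟩∘⟨ ≈-refl

  refl⟩∘⟨_ : ∀ {A B C} {f : B ⇒ C} {g i : A ⇒ B} → g ≈ i → f ∘ g ≈ f ∘ i
  refl⟩∘⟨ p = ≈-refl ⟩∘⟨ p

  toHom-sym-inverseʳ : ∀ {A B} (p : A ≡ B) → toHom p ∘ toHom (sym p) ≈ id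
  toHom-sym-inverseʳ refl = identityˡ

  toHom-sym-inverseˡ : ∀ {A B} (p : A ≡ B) → toHom (sym p) ∘ toHom p ≈ id
  toHom-sym-inverseˡ refl = identityˡ

  transpose-square : ∀ {A B C D} {s : B ⇒ D} {r : D ⇒ B} {h : A ⇒ B} {m : C ⇒ D}
                     {v : A ⇒ C} {w : C ⇒ A} →
                     s ∘ h ≈ m ∘ v → r ∘ s ≈ id → v ∘ w ≈ id → r ∘ m ≈ h ∘ w
  transpose-square {s = s} {r} {h} {m} {v} {w} sq rs vw = begin
    r ∘ m               ≈⟨ identityʳ ⟨
    (r ∘ m) ∘ id        ≈⟨ refl⟩∘⟨ vw ⟨
    (r ∘ m) ∘ (v ∘ w)   ≈⟨ assoc ⟩
    r ∘ (m ∘ (v ∘ w))   ≈⟨ refl⟩∘⟨ assoc ⟨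
    r ∘ ((m ∘ v) ∘ w)   ≈⟨ refl⟩∘⟨ (sq ⟩∘⟨refl) ⟨
    r ∘ ((s ∘ h) ∘ w)   ≈⟨ refl⟩∘⟨ assoc ⟩
    r ∘ (s ∘ (h ∘ w))   ≈⟨ assoc ⟨
    (r ∘ s) ∘ (h ∘ w)   ≈⟨ rs ⟩∘⟨refl ⟩
    id ∘ (h ∘ w)        ≈⟨ identityˡ ⟩
    h ∘ w               ∎

module MonoidalLemmas {o ℓ e} {C : Category o ℓ e} (M : Monoidal C) where
  open Category C
  open Monoidal M
  open CategoryLemmas C

  id⊗-⊗id-interchange : ∀ {A A' B B' P} {p : A' ⊗₀ B' ⇒ P} {c : B ⇒ B'} {s : A ⇒ A'} →
                        (p ∘ (id ⊗₁ c)) ∘ (s ⊗₁ id) ≈ (p ∘ (s ⊗₁ id)) ∘ (id ⊗₁ c)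
  id⊗-⊗id-interchange {p = p} {c} {s} = begin
    (p ∘ (id ⊗₁ c)) ∘ (s ⊗₁ id)   ≈⟨ assoc ⟩
    p ∘ ((id ⊗₁ c) ∘ (s ⊗₁ id))   ≈⟨ refl⟩∘⟨ ⊗-∘ ⟨
    p ∘ ((id ∘ s) ⊗₁ (c ∘ id))    ≈⟨ refl⟩∘⟨ ⊗-resp-≈ (≈-trans identityˡ (≈-sym identityʳ))
                                                       (≈-trans identityʳ (≈-sym identityˡ)) ⟩
    p ∘ ((s ∘ id) ⊗₁ (id ∘ c))    ≈⟨ refl⟩∘⟨ ⊗-∘ ⟩
    p ∘ ((s ⊗₁ id) ∘ (id ⊗₁ c))   ≈⟨ assoc ⟨
    (p ∘ (s ⊗₁ id)) ∘ (id ⊗₁ c)   ∎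

  id⊗-inverse : ∀ {A B C'} {f : B ⇒ C'} {g : C' ⇒ B} → g ∘ f ≈ id → (id {A} ⊗₁ g) ∘ (id ⊗₁ f) ≈ id
  id⊗-inverse gf = ≈-trans (≈-sym ⊗-∘) (≈-trans (⊗-resp-≈ identityˡ gf) ⊗-id)

  id⊗-∘-α⇒ : ∀ {A B C' D P} {p : B ⊗₀ D ⇒ P} {q : C' ⇒ D} →
             (id {A} ⊗₁ (p ∘ (id ⊗₁ q))) ∘ α⇒ ≈ ((id ⊗₁ p) ∘ α⇒) ∘ (id ⊗₁ q)
  id⊗-∘-α⇒ {p = p} {q} = begin
    (id ⊗₁ (p ∘ (id ⊗₁ q))) ∘ α⇒          ≈⟨ ≈-trans (⊗-resp-≈ (≈-sym identityˡ) ≈-refl) ⊗-∘ ⟩∘⟨refl ⟩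
    ((id ⊗₁ p) ∘ (id ⊗₁ (id ⊗₁ q))) ∘ α⇒  ≈⟨ assoc ⟩
    (id ⊗₁ p) ∘ ((id ⊗₁ (id ⊗₁ q)) ∘ α⇒)  ≈⟨ refl⟩∘⟨ α-natural ⟨
    (id ⊗₁ p) ∘ (α⇒ ∘ ((id ⊗₁ id) ⊗₁ q))  ≈⟨ refl⟩∘⟨ (refl⟩∘⟨ ⊗-resp-≈ ⊗-id ≈-refl) ⟩
    (id ⊗₁ p) ∘ (α⇒ ∘ (id ⊗₁ q))          ≈⟨ assoc ⟨
    ((id ⊗₁ p) ∘ α⇒) ∘ (id ⊗₁ q)          ∎

module FinalCoalgebraFamily {o ℓ e} (L : SeelyCategory o ℓ e) {I : Set}
    (F : StrongFunctor L (I ⊎ ⊤))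
    (Z : Objs L I → SeelyCategory.Obj L)
    (fix : ∀ X → proj₁ F (ext L X (Z X)) ≡ Z X)
    (final : ∀ X → IsFinalCoalgebra L (section L F X) (Z X) (SeelyCategory.toHom L (sym (fix X))))
    where
  open SeelyCategory L
  open CategoryLemmas category
  open MonoidalLemmas monoidal
  open StrongFunctorOn (proj₂ F)

  F₀ : Objs L (I ⊎ ⊤) → Obj
  F₀ = proj₁ F

  infixr 10 _⊗ᵛ_
  _⊗ᵛ_ : ∀ {J : Set} → Obj → Objs L J → Objs L J
  _⊗ᵛ_ = _⊗⃗_ L

  out : (X : Objs L I) → Z X ⇒ F₀ (ext L X (Z X))
  out X = toHom (sym (fix X))

  out⁻¹ : (X : Objs L I) → F₀ (ext L X (Z X)) ⇒ Z X
  out⁻¹ X = toHom (fix X)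

  F₁-extᴴ : ∀ {D X A} {g : Homs L D (ext L X A)} {k : ∀ i → D (inj₁ i) ⇒ X i}
            {h : D (inj₂ tt) ⇒ A} →
            (∀ i → g (inj₁ i) ≈ k i) → g (inj₂ tt) ≈ h → F₁ g ≈ F₁ (extᴴ L k h)
  F₁-extᴴ gk gh = F-resp-≈ λ { (inj₁ i) → gk i ; (inj₂ _) → gh }

  paste-squares : ∀ {A B P D₁ D₂ E} {c : B ⇒ F₀ E} {h : P ⇒ B} {m : A ⇒ P}
                  {b₁ : P ⇒ F₀ D₁} {b₂ : A ⇒ F₀ D₂} {g₁ : Homs L D₁ E} {g₂ : Homs L D₂ D₁} →
                  c ∘ h ≈ F₁ g₁ ∘ b₁ → b₁ ∘ m ≈ F₁ g₂ ∘ b₂ →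
                  c ∘ (h ∘ m) ≈ F₁ (λ i → g₁ i ∘ g₂ i) ∘ b₂
  paste-squares {c = c} {h} {m} {b₁} {b₂} {g₁} {g₂} sq₁ sq₂ = begin
    c ∘ (h ∘ m)               ≈⟨ assoc ⟨
    (c ∘ h) ∘ m               ≈⟨ sq₁ ⟩∘⟨refl ⟩
    (F₁ g₁ ∘ b₁) ∘ m          ≈⟨ assoc ⟩
    F₁ g₁ ∘ (b₁ ∘ m)          ≈⟨ refl⟩∘⟨ sq₂ ⟩
    F₁ g₁ ∘ (F₁ g₂ ∘ b₂)      ≈⟨ assoc ⟨
    (F₁ g₁ ∘ F₁ g₂) ∘ b₂      ≈⟨ F-∘ ⟩∘⟨refl ⟨
    F₁ (λ i → g₁ i ∘ g₂ i) ∘ b₂ ∎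

  module _ {X : Objs L I} {A : Obj} {D : Objs L (I ⊎ ⊤)}
           (b : A ⇒ F₀ D) (k : ∀ i → D (inj₁ i) ⇒ X i) (l : D (inj₂ tt) ⇒ A) where

    IsCoiteration : A ⇒ Z X → Set e
    IsCoiteration h = out X ∘ h ≈ F₁ (extᴴ L k (h ∘ l)) ∘ b

    private
      coalgebra : A ⇒ F₀ (ext L X A)
      coalgebra = F₁ (extᴴ L k l) ∘ b

      coalgebra-morphism⇔coiteration :
        ∀ (h : A ⇒ Z X) →
        F₁ (extᴴ L {D = ext L X A} (λ i → id) h) ∘ coalgebra ≈ F₁ (extᴴ L k (h ∘ l)) ∘ b
      coalgebra-morphism⇔coiteration h =
        ≈-trans (≈-sym assoc)
                (≈-trans (≈-sym F-∘ ⟩∘⟨refl) (F₁-extᴴ (λ _ → identityˡ) ≈-refl ⟩∘⟨refl))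

      universal : Σ (A ⇒ Z X) λ h → IsCoalgebraMorphism L (section L F X) coalgebra (out X) h ×
                    (∀ h' → IsCoalgebraMorphism L (section L F X) coalgebra (out X) h' → h' ≈ h)
      universal = final X A coalgebra

    coiterate : A ⇒ Z X
    coiterate = proj₁ universal

    coiterate-isCoiteration : IsCoiteration coiterate
    coiterate-isCoiteration =
      ≈-trans (proj₁ (proj₂ universal)) (coalgebra-morphism⇔coiteration coiterate)

    coiteration-unique : ∀ {h} → IsCoiteration h → h ≈ coiterate
    coiteration-unique {h} coit =
      proj₂ (proj₂ universal) h (≈-trans coit (≈-sym (coalgebra-morphism⇔coiteration h)))

    coiterations-agree : ∀ {h h'} → IsCoiteration h → IsCoiteration h' → h ≈ h'
    coiterations-agree coit coit' = ≈-trans (coiteration-unique coit) (≈-sym (coiteration-unique coit'))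

    coiteration-intro : ∀ {h} {g : Homs L D (ext L X (Z X))} → out X ∘ h ≈ F₁ g ∘ b →
                        (∀ i → g (inj₁ i) ≈ k i) → g (inj₂ tt) ≈ h ∘ l → IsCoiteration h
    coiteration-intro sq gk gl = ≈-trans sq (F₁-extᴴ gk gl ⟩∘⟨refl)

  νF₁ : ∀ {X Y : Objs L I} → Homs L X Y → Z X ⇒ Z Y
  νF₁ {X} f = coiterate (out X) f id

  νF₁-square : ∀ {X Y} (f : Homs L X Y) → out Y ∘ νF₁ f ≈ F₁ (extᴴ L f (νF₁ f)) ∘ out X
  νF₁-square {X} f =
    ≈-trans (coiterate-isCoiteration (out X) f id) (F₁-extᴴ (λ _ → ≈-refl) identityʳ ⟩∘⟨refl)

  νF₁-unique : ∀ {X Y} {f : Homs L X Y} {h : Z X ⇒ Z Y} →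
               out Y ∘ h ≈ F₁ (extᴴ L f h) ∘ out X → h ≈ νF₁ f
  νF₁-unique {X} {f = f} sq =
    coiteration-unique (out X) f id (coiteration-intro (out X) f id sq (λ _ → ≈-refl) (≈-sym identityʳ))

  νF₁-id : ∀ {X} → νF₁ {X} (λ i → id) ≈ id
  νF₁-id {X} = ≈-sym (νF₁-unique (begin
    out X ∘ id                            ≈⟨ identityʳ ⟩
    out X                                 ≈⟨ identityˡ ⟨
    id ∘ out X                            ≈⟨ ≈-trans (≈-sym F-id) (F₁-extᴴ (λ _ → ≈-refl) ≈-refl) ⟩∘⟨refl ⟩
    F₁ (extᴴ L (λ i → id) id) ∘ out X     ∎))

  νF₁-∘ : ∀ {X Y W} {f : Homs L Y W} {g : Homs L X Y} → νF₁ (λ i → f i ∘ g i) ≈ νF₁ f ∘ νF₁ g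
  νF₁-∘ {f = f} {g} = ≈-sym (νF₁-unique
    (≈-trans (paste-squares (νF₁-square f) (νF₁-square g)) (F₁-extᴴ (λ _ → ≈-refl) ≈-refl ⟩∘⟨refl)))

  νF₁-resp-≈ : ∀ {X Y} {f g : Homs L X Y} → (∀ i → f i ≈ g i) → νF₁ f ≈ νF₁ g
  νF₁-resp-≈ {f = f} f≈g = νF₁-unique (≈-trans (νF₁-square f) (F₁-extᴴ f≈g ≈-refl ⟩∘⟨refl))

  strengthened-out : (Y : Obj) (X : Objs L I) → !₀ Y ⊗₀ Z X ⇒ F₀ (!₀ Y ⊗ᵛ ext L X (Z X))
  strengthened-out Y X = φ Y (ext L X (Z X)) ∘ (id ⊗₁ out X)

  ψ : (Y : Obj) (X : Objs L I) → !₀ Y ⊗₀ Z X ⇒ Z (!₀ Y ⊗ᵛ X)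
  ψ Y X = coiterate (strengthened-out Y X) (λ i → id) id

  ψ-square : ∀ Y X →
             out (!₀ Y ⊗ᵛ X) ∘ ψ Y X ≈ F₁ (extᴴ L (λ i → id) (ψ Y X)) ∘ strengthened-out Y X
  ψ-square Y X = ≈-trans (coiterate-isCoiteration (strengthened-out Y X) (λ i → id) id)
                         (F₁-extᴴ (λ _ → ≈-refl) identityʳ ⟩∘⟨refl)

  ψ-unique : ∀ {Y X} {h : !₀ Y ⊗₀ Z X ⇒ Z (!₀ Y ⊗ᵛ X)} →
             out (!₀ Y ⊗ᵛ X) ∘ h ≈ F₁ (extᴴ L (λ i → id) h) ∘ strengthened-out Y X → h ≈ ψ Y X
  ψ-unique {Y} {X} sq = coiteration-unique (strengthened-out Y X) (λ i → id) id
    (coiteration-intro (strengthened-out Y X) (λ i → id) id sq (λ _ → ≈-refl) (≈-sym identityʳ))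

  strengthen-square : ∀ {Y Y' : Obj} {f : Y ⇒ Y'} {A A' : Obj} {D D' : Objs L (I ⊎ ⊤)}
                      {c : A' ⇒ F₀ D'} {h : A ⇒ A'} {b : A ⇒ F₀ D} {g : Homs L D D'} →
                      c ∘ h ≈ F₁ g ∘ b →
                      (φ Y' D' ∘ (id ⊗₁ c)) ∘ (!₁ f ⊗₁ h)
                        ≈ F₁ (λ i → !₁ f ⊗₁ g i) ∘ (φ Y D ∘ (id ⊗₁ b))
  strengthen-square {Y} {Y'} {f} {D = D} {D'} {c} {h} {b} {g} sq = begin
    (φ Y' D' ∘ (id ⊗₁ c)) ∘ (!₁ f ⊗₁ h)       ≈⟨ assoc ⟩
    φ Y' D' ∘ ((id ⊗₁ c) ∘ (!₁ f ⊗₁ h))       ≈⟨ refl⟩∘⟨ ≈-trans (≈-sym ⊗-∘) (⊗-resp-≈ identityˡ sq) ⟩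
    φ Y' D' ∘ (!₁ f ⊗₁ (F₁ g ∘ b))            ≈⟨ refl⟩∘⟨ ≈-trans (⊗-resp-≈ (≈-sym identityʳ) ≈-refl) ⊗-∘ ⟩
    φ Y' D' ∘ ((!₁ f ⊗₁ F₁ g) ∘ (id ⊗₁ b))    ≈⟨ assoc ⟨
    (φ Y' D' ∘ (!₁ f ⊗₁ F₁ g)) ∘ (id ⊗₁ b)    ≈⟨ φ-natural ⟩∘⟨refl ⟨
    (F₁ (λ i → !₁ f ⊗₁ g i) ∘ φ Y D) ∘ (id ⊗₁ b)  ≈⟨ assoc ⟩
    F₁ (λ i → !₁ f ⊗₁ g i) ∘ (φ Y D ∘ (id ⊗₁ b))  ∎

  νF₁-∘-ψ-isCoiteration : ∀ {Y X X'} (k : Homs L (!₀ Y ⊗ᵛ X) X') →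
                          IsCoiteration (strengthened-out Y X) k id (νF₁ k ∘ ψ Y X)
  νF₁-∘-ψ-isCoiteration {Y} {X} k = coiteration-intro (strengthened-out Y X) k id
    (paste-squares (νF₁-square k) (ψ-square Y X)) (λ _ → identityʳ) (≈-sym identityʳ)

  ψ-natural : ∀ {Y Y' X X'} {f : Y ⇒ Y'} {g : Homs L X X'} →
              νF₁ (λ i → !₁ f ⊗₁ g i) ∘ ψ Y X ≈ ψ Y' X' ∘ (!₁ f ⊗₁ νF₁ g)
  ψ-natural {Y} {Y'} {X} {X'} {f} {g} =
    coiterations-agree (strengthened-out Y X) (λ i → !₁ f ⊗₁ g i) id
      (νF₁-∘-ψ-isCoiteration _)
      (coiteration-intro (strengthened-out Y X) _ id
        (paste-squares (ψ-square Y' X') (strengthen-square (νF₁-square g)))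
        (λ _ → identityˡ) (≈-sym identityʳ))

  ψ-dig : ∀ {Y X} → ψ (!₀ Y) X ∘ (dig ⊗₁ id) ≈ νF₁ (λ i → dig ⊗₁ id) ∘ ψ Y X
  ψ-dig {Y} {X} = coiterations-agree (strengthened-out Y X) (λ i → dig ⊗₁ id) id
    (coiteration-intro (strengthened-out Y X) _ id
      (paste-squares (ψ-square (!₀ Y) X) dig-square) (λ _ → identityˡ) (≈-sym identityʳ))
    (νF₁-∘-ψ-isCoiteration _)
    where
    dig-square : strengthened-out (!₀ Y) X ∘ (dig ⊗₁ id)
                   ≈ F₁ (λ i → dig ⊗₁ id) ∘ strengthened-out Y X
    dig-square = ≈-trans id⊗-⊗id-interchange (≈-trans (φ-dig ⟩∘⟨refl) assoc)

  ψ-m⁰ : ∀ {X} → ψ ⊤ₒ X ∘ (m⁰ ⊗₁ id) ≈ νF₁ (λ i → (m⁰ ⊗₁ id) ∘ λ⇐) ∘ λ⇒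
  ψ-m⁰ {X} = coiterations-agree b k λ⇐
    (coiteration-intro b k λ⇐ (paste-squares (ψ-square ⊤ₒ X) m⁰-square)
      (λ _ → identityˡ) (≈-sym assoc))
    (coiteration-intro b k λ⇐ (paste-squares (νF₁-square k) unitor-square)
      (λ _ → identityʳ) λ⇐-cancel)
    where
    b : unit ⊗₀ Z X ⇒ F₀ (ext L X (Z X))
    b = λ⇒ ∘ (id ⊗₁ out X)
    k : Homs L X (!₀ ⊤ₒ ⊗ᵛ X)
    k i = (m⁰ ⊗₁ id) ∘ λ⇐
    m⁰-square : strengthened-out ⊤ₒ X ∘ (m⁰ ⊗₁ id) ≈ F₁ (λ i → (m⁰ ⊗₁ id) ∘ λ⇐) ∘ b
    m⁰-square = ≈-trans id⊗-⊗id-interchange (≈-trans (φ-m⁰ ⟩∘⟨refl) assoc)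
    unitor-square : out X ∘ λ⇒ ≈ F₁ {ext L X (Z X)} (λ i → id) ∘ b
    unitor-square = ≈-trans λ-natural (≈-trans (≈-sym identityˡ) (≈-sym F-id ⟩∘⟨refl))
    λ⇐-cancel : νF₁ k ∘ id ≈ (νF₁ k ∘ λ⇒) ∘ λ⇐
    λ⇐-cancel = begin
      νF₁ k ∘ id             ≈⟨ refl⟩∘⟨ λ-isoʳ ⟨
      νF₁ k ∘ (λ⇒ ∘ λ⇐)      ≈⟨ assoc ⟨
      (νF₁ k ∘ λ⇒) ∘ λ⇐      ∎

  strengthened-out² : (Y₁ Y₂ : Obj) (X : Objs L I) →
                      (!₀ Y₁ ⊗₀ !₀ Y₂) ⊗₀ Z X ⇒ F₀ (!₀ Y₁ ⊗ᵛ (!₀ Y₂ ⊗ᵛ ext L X (Z X)))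
  strengthened-out² Y₁ Y₂ X =
    (φ Y₁ (!₀ Y₂ ⊗ᵛ ext L X (Z X)) ∘ ((id ⊗₁ φ Y₂ (ext L X (Z X))) ∘ α⇒)) ∘ (id ⊗₁ out X)

  ψ-∘-ψ-square : ∀ {Y₁ Y₂ X} →
                 strengthened-out Y₁ (!₀ Y₂ ⊗ᵛ X) ∘ ((id ⊗₁ ψ Y₂ X) ∘ α⇒)
                   ≈ F₁ (λ i → !₁ id ⊗₁ extᴴ L {D = !₀ Y₂ ⊗ᵛ ext L X (Z X)} (λ j → id) (ψ Y₂ X) i)
                       ∘ strengthened-out² Y₁ Y₂ X
  ψ-∘-ψ-square {Y₁} {Y₂} {X} = begin
    strengthened-out Y₁ (!₀ Y₂ ⊗ᵛ X) ∘ ((id ⊗₁ ψ₂) ∘ α⇒)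
      ≈⟨ assoc ⟨
    (strengthened-out Y₁ (!₀ Y₂ ⊗ᵛ X) ∘ (id ⊗₁ ψ₂)) ∘ α⇒
      ≈⟨ (refl⟩∘⟨ ⊗-resp-≈ (≈-sym !-id) ≈-refl) ⟩∘⟨refl ⟩
    (strengthened-out Y₁ (!₀ Y₂ ⊗ᵛ X) ∘ (!₁ id ⊗₁ ψ₂)) ∘ α⇒
      ≈⟨ strengthen-square (ψ-square Y₂ X) ⟩∘⟨refl ⟩
    (F₁ G ∘ (φ₁ ∘ (id ⊗₁ strengthened-out Y₂ X))) ∘ α⇒
      ≈⟨ ≈-trans assoc (refl⟩∘⟨ assoc) ⟩
    F₁ G ∘ (φ₁ ∘ ((id ⊗₁ (φ₂ ∘ (id ⊗₁ out X))) ∘ α⇒))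
      ≈⟨ refl⟩∘⟨ (refl⟩∘⟨ id⊗-∘-α⇒) ⟩
    F₁ G ∘ (φ₁ ∘ (((id ⊗₁ φ₂) ∘ α⇒) ∘ (id ⊗₁ out X)))
      ≈⟨ refl⟩∘⟨ assoc ⟨
    F₁ G ∘ strengthened-out² Y₁ Y₂ X
      ∎
    where
    φ₁ : !₀ Y₁ ⊗₀ F₀ (!₀ Y₂ ⊗ᵛ ext L X (Z X)) ⇒ F₀ (!₀ Y₁ ⊗ᵛ (!₀ Y₂ ⊗ᵛ ext L X (Z X)))
    φ₁ = φ Y₁ (!₀ Y₂ ⊗ᵛ ext L X (Z X))
    φ₂ : !₀ Y₂ ⊗₀ F₀ (ext L X (Z X)) ⇒ F₀ (!₀ Y₂ ⊗ᵛ ext L X (Z X))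
    φ₂ = φ Y₂ (ext L X (Z X))
    ψ₂ : !₀ Y₂ ⊗₀ Z X ⇒ Z (!₀ Y₂ ⊗ᵛ X)
    ψ₂ = ψ Y₂ X
    G : Homs L (!₀ Y₁ ⊗ᵛ (!₀ Y₂ ⊗ᵛ ext L X (Z X))) (!₀ Y₁ ⊗ᵛ ext L (!₀ Y₂ ⊗ᵛ X) (Z (!₀ Y₂ ⊗ᵛ X)))
    G i = !₁ id ⊗₁ extᴴ L {D = !₀ Y₂ ⊗ᵛ ext L X (Z X)} (λ j → id) ψ₂ i

  ψ-m² : ∀ {Y₁ Y₂ X} →
         ψ (Y₁ & Y₂) X ∘ (m² ⊗₁ id)
           ≈ νF₁ (λ i → (m² ⊗₁ id) ∘ α⇐) ∘ (ψ Y₁ (!₀ Y₂ ⊗ᵛ X) ∘ ((id ⊗₁ ψ Y₂ X) ∘ α⇒))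
  ψ-m² {Y₁} {Y₂} {X} = coiterations-agree b k α⇐
    (coiteration-intro b k α⇐ (paste-squares (ψ-square (Y₁ & Y₂) X) m²-square)
      (λ _ → identityˡ) (≈-sym assoc))
    (coiteration-intro b k α⇐
      (paste-squares (νF₁-square k) (paste-squares (ψ-square Y₁ (!₀ Y₂ ⊗ᵛ X)) ψ-∘-ψ-square))
      (λ _ → k-cancel) α⇐-cancel)
    where
    b : (!₀ Y₁ ⊗₀ !₀ Y₂) ⊗₀ Z X ⇒ F₀ (!₀ Y₁ ⊗ᵛ (!₀ Y₂ ⊗ᵛ ext L X (Z X)))
    b = strengthened-out² Y₁ Y₂ X
    k : Homs L (!₀ Y₁ ⊗ᵛ (!₀ Y₂ ⊗ᵛ X)) (!₀ (Y₁ & Y₂) ⊗ᵛ X)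
    k i = (m² ⊗₁ id) ∘ α⇐
    ψ₁ : !₀ Y₁ ⊗₀ Z (!₀ Y₂ ⊗ᵛ X) ⇒ Z (!₀ Y₁ ⊗ᵛ (!₀ Y₂ ⊗ᵛ X))
    ψ₁ = ψ Y₁ (!₀ Y₂ ⊗ᵛ X)
    ψ₂ : !₀ Y₂ ⊗₀ Z X ⇒ Z (!₀ Y₂ ⊗ᵛ X)
    ψ₂ = ψ Y₂ X
    m²-square : strengthened-out (Y₁ & Y₂) X ∘ (m² ⊗₁ id) ≈ F₁ (λ i → (m² ⊗₁ id) ∘ α⇐) ∘ b
    m²-square = ≈-trans id⊗-⊗id-interchange (≈-trans (φ-m² ⟩∘⟨refl) assoc)
    k-cancel : ∀ {i} → k i ∘ (id ∘ (!₁ id ⊗₁ id)) ≈ k i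
    k-cancel = ≈-trans (refl⟩∘⟨ ≈-trans identityˡ (≈-trans (⊗-resp-≈ !-id ≈-refl) ⊗-id)) identityʳ
    α⇐-cancel : νF₁ k ∘ (ψ₁ ∘ (!₁ id ⊗₁ ψ₂)) ≈ (νF₁ k ∘ (ψ₁ ∘ ((id ⊗₁ ψ₂) ∘ α⇒))) ∘ α⇐
    α⇐-cancel = begin
      νF₁ k ∘ (ψ₁ ∘ (!₁ id ⊗₁ ψ₂))                 ≈⟨ refl⟩∘⟨ (refl⟩∘⟨ ⊗-resp-≈ !-id ≈-refl) ⟩
      νF₁ k ∘ (ψ₁ ∘ (id ⊗₁ ψ₂))                    ≈⟨ refl⟩∘⟨ (refl⟩∘⟨ identityʳ) ⟨
      νF₁ k ∘ (ψ₁ ∘ ((id ⊗₁ ψ₂) ∘ id))             ≈⟨ refl⟩∘⟨ (refl⟩∘⟨ (refl⟩∘⟨ α-isoʳ)) ⟨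
      νF₁ k ∘ (ψ₁ ∘ ((id ⊗₁ ψ₂) ∘ (α⇒ ∘ α⇐)))      ≈⟨ refl⟩∘⟨ (refl⟩∘⟨ assoc) ⟨
      νF₁ k ∘ (ψ₁ ∘ (((id ⊗₁ ψ₂) ∘ α⇒) ∘ α⇐))      ≈⟨ refl⟩∘⟨ assoc ⟨
      νF₁ k ∘ ((ψ₁ ∘ ((id ⊗₁ ψ₂) ∘ α⇒)) ∘ α⇐)      ≈⟨ assoc ⟨
      (νF₁ k ∘ (ψ₁ ∘ ((id ⊗₁ ψ₂) ∘ α⇒))) ∘ α⇐      ∎

  νF : StrongFunctorOn L I Z
  νF = record
    { F₁ = νF₁ ; F-id = νF₁-id ; F-∘ = νF₁-∘ ; F-resp-≈ = νF₁-resp-≈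
    ; φ = ψ ; φ-natural = ψ-natural ; φ-m² = ψ-m² ; φ-m⁰ = ψ-m⁰ ; φ-dig = ψ-dig }

  νF-isNu : IsNuOf L F Z fix νF
  νF-isNu =
      (λ {X} {X'} f → transpose-square (νF₁-square f)
                        (toHom-sym-inverseʳ (fix X')) (toHom-sym-inverseˡ (fix X)))
    , (λ Y X → transpose-square (≈-trans (ψ-square Y X) (≈-sym assoc))
                 (toHom-sym-inverseʳ (fix (!₀ Y ⊗ᵛ X))) (id⊗-inverse (toHom-sym-inverseˡ (fix X))))

  νF-unique : ∀ νF' → IsNuOf L F Z fix νF' → SameStrongFunctor L νF νF'
  νF-unique νF' (fold-νF₁' , fold-ψ') =
      (λ {X} {X'} f → ≈-sym (νF₁-unique
        (transpose-square (fold-νF₁' f) (toHom-sym-inverseˡ (fix X')) (toHom-sym-inverseʳ (fix X)))))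
    , (λ Y X → ≈-sym (ψ-unique (≈-trans
        (transpose-square (fold-ψ' Y X) (toHom-sym-inverseˡ (fix (!₀ Y ⊗ᵛ X)))
                          (id⊗-inverse (toHom-sym-inverseʳ (fix X))))
        assoc)))

lemma2p3 : ∀ {o ℓ e} (L : SeelyCategory o ℓ e) (n : ℕ)
    (F : StrongFunctor L (Fin n ⊎ ⊤))
    (Z : Objs L (Fin n) → SeelyCategory.Obj L)
    (fix : ∀ X → proj₁ F (ext L X (Z X)) ≡ Z X) →
    (∀ X → IsFinalCoalgebra L (section L F X) (Z X) (SeelyCategory.toHom L (sym (fix X)))) →
    Σ (StrongFunctorOn L (Fin n) Z) λ νF →
      IsNuOf L F Z fix νF × (∀ νF' → IsNuOf L F Z fix νF' → SameStrongFunctor L νF νF')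
lemma2p3 L n F Z fix final = νF , νF-isNu , νF-unique
  where open FinalCoalgebraFamily L F Z fix final
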